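{- There exist constants $c, d$ such that for every positive integer $n$ there is a graph with at most $c\,n$ vertices, clique-width at most $d$, and minor-matching hypertreewidth at least $n$.
   Context: A tree decomposition of $G$ is a pair $(T,\mathrm{bag})$, $T$ a tree, $\mathrm{bag}: V(T)\to 2^{V(G)}$, such that every edge of $G$ lies inside some bag and for each vertex $v$ the nodes whose bags contain $v$ form a non-empty connected subtree. For $X\subseteq V(G)$, $\mu(X)$ is the maximum size of an induced matching $M$ of $G$ (the subgraph induced by the endpoints of $M$ has no edges besides $M$) such that every edge of $M$ has at least one endpoint in $X$. The minor-matching hypertreewidth of $G$ is the minimum over tree decompositions of $\max_t \mu(\mathrm{bag}(t))$. Clique-width is the standard graph parameter of Courcelle, Engelfriet and Rozenberg. -}

module Defs where

open import Data.Nat using (ℕ; zero; suc; _+_; _≤_)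
open import Data.Fin using (Fin; splitAt; _≟_)
open import Data.Fin.Subset using (Subset) renaming (_∈_ to _∈ₛ_)
open import Data.Bool using (Bool; true; false; _∨_; _∧_; if_then_else_)
open import Data.List using (List; []; _∷_; length; concatMap; last)
open import Data.List.Membership.Propositional using () renaming (_∈_ to _∈ₗ_)
open import Data.List.Relation.Unary.All using (All)
open import Data.List.Relation.Unary.Linked using (Linked)
open import Data.List.Relation.Unary.Unique.Propositional using (Unique)
open import Data.Maybe using (just)
open import Data.Product using (Σ; ∃; ∃-syntax; _×_; _,_)
open import Data.Sum using (_⊎_; inj₁; inj₂; [_,_])
open import Function using (_∘_)
open import Function.Bundles using (_↔_; Inverse)
open import Relation.Binary.PropositionalEquality using (_≡_; _≢_)
open import Relation.Nullary.Decidable using (⌊_⌋)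

record Graph (n : ℕ) : Set where
  field
    adj    : Fin n → Fin n → Bool
    sym    : ∀ u v → adj u v ≡ adj v u
    irrefl : ∀ u → adj u u ≡ false

open Graph public

Edge : ∀ {n} → Graph n → Fin n → Fin n → Set
Edge G u v = adj G u v ≡ true

IsWalk : ∀ {n} → Graph n → Fin n → Fin n → List (Fin n) → Set
IsWalk G u v ws = Σ (List _) (λ xs → ws ≡ u ∷ xs) × last ws ≡ just v × Linked (Edge G) ws

IsPath : ∀ {n} → Graph n → Fin n → Fin n → List (Fin n) → Set
IsPath G u v ws = IsWalk G u v ws × Unique ws

IsTree : ∀ {k} → Graph k → Set
IsTree {k} T = (1 ≤ k) ×
  (∀ u v → Σ (List (Fin k)) λ ps → IsPath T u v ps × (∀ qs → IsPath T u v qs → qs ≡ ps))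

ConnectedIn : ∀ {k} → Graph k → (Fin k → Set) → Set
ConnectedIn T S = ∀ s t → S s → S t →
  Σ (List _) λ ws → IsWalk T s t ws × All S ws

record TreeDecomposition {n : ℕ} (G : Graph n) : Set₁ where
  field
    k        : ℕ
    tree     : Graph k
    isTree   : IsTree tree
    bag      : Fin k → Subset n
    edgeCov  : ∀ u v → Edge G u v → ∃[ t ] (u ∈ₛ bag t × v ∈ₛ bag t)
    nonEmpty : ∀ v → ∃[ t ] (v ∈ₛ bag t)
    conn     : ∀ v → ConnectedIn tree (λ t → v ∈ₛ bag t)

endpoints : ∀ {n} → List (Fin n × Fin n) → List (Fin n)
endpoints = concatMap (λ { (a , b) → a ∷ b ∷ [] })

IsInducedMatching : ∀ {n} → Graph n → List (Fin n × Fin n) → Set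
IsInducedMatching G M =
  All (λ { (a , b) → Edge G a b }) M ×
  Unique (endpoints M) ×
  (∀ x y → x ∈ₗ endpoints M → y ∈ₗ endpoints M → Edge G x y →
     ((x , y) ∈ₗ M) ⊎ ((y , x) ∈ₗ M))

MuAtLeast : ∀ {n} → Graph n → Subset n → ℕ → Set
MuAtLeast G X m = Σ (List _) λ M →
  IsInducedMatching G M × All (λ { (a , b) → (a ∈ₛ X) ⊎ (b ∈ₛ X) }) M × m ≤ length M

-- minor-matching hypertreewidth ≥ m, i.e.
-- min over tree decompositions of max over bags of μ(bag) is ≥ m
MMHWAtLeast : ∀ {n} → Graph n → ℕ → Set₁
MMHWAtLeast G m = (D : TreeDecomposition G) →
  ∃[ t ] MuAtLeast G (TreeDecomposition.bag D t) m

data CWExpr (d : ℕ) : ℕ → Set where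
  vertex  : Fin d → CWExpr d 1
  union   : ∀ {a b} → CWExpr d a → CWExpr d b → CWExpr d (a + b)
  join    : ∀ {a} (i j : Fin d) → i ≢ j → CWExpr d a → CWExpr d a
  relabel : ∀ {a} (i j : Fin d) → CWExpr d a → CWExpr d a

record LGraph (d n : ℕ) : Set where
  field
    ladj : Fin n → Fin n → Bool
    lab  : Fin n → Fin d

open LGraph public

eqB : ∀ {d} → Fin d → Fin d → Bool
eqB i j = ⌊ i ≟ j ⌋

⟦_⟧ : ∀ {d n} → CWExpr d n → LGraph d n
⟦ vertex i ⟧ = record { ladj = λ _ _ → false ; lab = λ _ → i }
⟦ union {a} e f ⟧ = record
  { ladj = λ u v → adjU (splitAt a u) (splitAt a v)
  ; lab  = [ lab ⟦ e ⟧ , lab ⟦ f ⟧ ] ∘ splitAt a }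
  where
  adjU : _ ⊎ _ → _ ⊎ _ → Bool
  adjU (inj₁ x) (inj₁ y) = ladj ⟦ e ⟧ x y
  adjU (inj₂ x) (inj₂ y) = ladj ⟦ f ⟧ x y
  adjU _ _ = false
⟦ join i j _ e ⟧ = record
  { ladj = λ u v → ladj ⟦ e ⟧ u v
                   ∨ (eqB (lab ⟦ e ⟧ u) i ∧ eqB (lab ⟦ e ⟧ v) j)
                   ∨ (eqB (lab ⟦ e ⟧ u) j ∧ eqB (lab ⟦ e ⟧ v) i)
  ; lab  = lab ⟦ e ⟧ }
⟦ relabel i j e ⟧ = record
  { ladj = ladj ⟦ e ⟧
  ; lab  = λ u → if eqB (lab ⟦ e ⟧ u) i then j else lab ⟦ e ⟧ u }

CliqueWidthAtMost : ∀ {n} → Graph n → ℕ → Set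
CliqueWidthAtMost {n} G d = Σ (CWExpr d n) λ e → Σ (Fin n ↔ Fin n) λ f →
  ∀ u v → adj G u v ≡ ladj ⟦ e ⟧ (Inverse.to f u) (Inverse.to f v)

-- Let H = 2n and let G be the complete bipartite graph on hubs a_i, b_i (i < H) with a
-- pendant leaf attached to every hub; G has 4H = 8n vertices and is built by a
-- 3-expression. In any tree decomposition of G, the nodes whose bag contains a_i or b_i
-- form a subtree (a_i b_i is an edge), and any two of these subtrees meet (a_i b_j is an
-- edge). By the Helly property of subtrees of a tree some bag t meets every {a_i, b_i},
-- so t contains at least n hubs of one side. Their pendant edges form an induced
-- matching, since the hubs of one side are pairwise non-adjacent and so are the leaves.

module Submission where

open import Defs
open import Data.Nat using (ℕ; zero; suc; _+_; _*_; _≤_)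
open import Data.Nat.Properties using (_≤?_; ≰⇒>; +-mono-<; <⇒≱; +-suc; ≤-refl; ≤-reflexive)
open import Data.Nat.Tactic.RingSolver using (solve-∀)
open import Data.Fin using (Fin; zero; suc; splitAt; _↑ˡ_; _↑ʳ_; _≟_)
open import Data.Fin.Properties using (splitAt-↑ˡ; splitAt-↑ʳ)
open import Data.Fin.Subset using (Subset) renaming (_∈_ to _∈ₛ_)
open import Data.Fin.Subset.Properties using () renaming (_∈?_ to _∈ₛ?_)
open import Data.Bool using (true; false; _∨_; _∧_)
open import Data.Bool.Properties using (∨-comm; ∧-comm; ∨-identityʳ; ∧-zeroʳ)
open import Data.List using (List; []; _∷_; _++_; map; length; filter; allFin)
open import Data.List.Properties using (∷-injectiveʳ; length-map; length-tabulate)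
open import Data.List.Membership.Propositional using (_∈_)
open import Data.List.Membership.Propositional.Properties using (∈-∃++; ∈-++⁺ʳ; ∈-map⁺)
open import Data.List.Relation.Binary.Subset.Propositional using (_⊆_)
open import Data.List.Relation.Unary.All as All using (All; []; _∷_; universal)
open import Data.List.Relation.Unary.All.Properties using (¬Any⇒All¬; anti-mono; ++⁺; map⁺; all-filter)
open import Data.List.Relation.Unary.Any using (here; there)
open import Data.List.Relation.Unary.Linked using ([-]; _∷_)
open import Data.List.Relation.Unary.Unique.Propositional using (Unique; []; _∷_)
open import Data.List.Relation.Unary.Unique.Propositional.Properties using (allFin⁺; filter⁺)
open import Data.Maybe.Properties using (just-injective)
open import Data.Product using (Σ; ∃; _×_; _,_; proj₁; proj₂)
open import Data.Sum using (_⊎_; inj₁; inj₂; fromInj₂; swap)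
open import Function using (id; _∘_)
open import Function.Construct.Identity using (↔-id)
open import Relation.Binary.PropositionalEquality as ≡
  using (_≡_; _≢_; refl; trans; cong; cong₂)
open import Relation.Nullary using (yes; no; ¬_; contradiction)
open import Relation.Nullary.Decidable using (_×-dec_; _⊎-dec_)
open import Relation.Unary using (Decidable; _∩_; _∪_)
open import Relation.Unary.Properties using (∁?)

eqB-refl : ∀ {d} (i : Fin d) → eqB i i ≡ true
eqB-refl i with i ≟ i
... | yes _   = refl
... | no i≢i = contradiction refl i≢i

eqB-≢ : ∀ {d} {x j : Fin d} → x ≢ j → eqB x j ≡ false
eqB-≢ {x = x} {j} x≢j with x ≟ j
... | yes x≡j = contradiction x≡j x≢j
... | no _    = refl

eqB-exclusive : ∀ {d} {i j : Fin d} → i ≢ j → ∀ x → eqB x i ∧ eqB x j ≡ false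
eqB-exclusive {i = i} i≢j x with x ≟ i
... | yes refl = eqB-≢ i≢j
... | no _     = refl

ladj-sym : ∀ {d n} (e : CWExpr d n) u v → ladj ⟦ e ⟧ u v ≡ ladj ⟦ e ⟧ v u
ladj-sym (vertex _) u v = refl
ladj-sym (union {a} e f) u v with splitAt a u | splitAt a v
... | inj₁ x | inj₁ y = ladj-sym e x y
... | inj₁ _ | inj₂ _ = refl
... | inj₂ _ | inj₁ _ = refl
... | inj₂ x | inj₂ y = ladj-sym f x y
ladj-sym (join i j _ e) u v =
  cong₂ _∨_ (ladj-sym e u v)
    (trans (∨-comm (eqB lu i ∧ eqB lv j) _)
           (cong₂ _∨_ (∧-comm (eqB lu j) _) (∧-comm (eqB lu i) _)))
  where
  lu lv : Fin _
  lu = lab ⟦ e ⟧ u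
  lv = lab ⟦ e ⟧ v
ladj-sym (relabel _ _ e) u v = ladj-sym e u v

ladj-irrefl : ∀ {d n} (e : CWExpr d n) u → ladj ⟦ e ⟧ u u ≡ false
ladj-irrefl (vertex _) u = refl
ladj-irrefl (union {a} e f) u with splitAt a u
... | inj₁ x = ladj-irrefl e x
... | inj₂ x = ladj-irrefl f x
ladj-irrefl (join i j i≢j e) u =
  cong₂ _∨_ (ladj-irrefl e u)
    (cong₂ _∨_ (eqB-exclusive i≢j (lab ⟦ e ⟧ u)) (eqB-exclusive (i≢j ∘ ≡.sym) (lab ⟦ e ⟧ u)))
ladj-irrefl (relabel _ _ e) u = ladj-irrefl e u

toGraph : ∀ {d n} → CWExpr d n → Graph n
toGraph e = record { adj = ladj ⟦ e ⟧ ; sym = ladj-sym e ; irrefl = ladj-irrefl e }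

cliqueWidth-toGraph : ∀ {d n} (e : CWExpr d n) → CliqueWidthAtMost (toGraph e) d
cliqueWidth-toGraph e = e , ↔-id _ , λ _ _ → refl

module _ {d a b} {i j : Fin d} (i≢j : i ≢ j) (e : CWExpr d a) (f : CWExpr d b) where

  join-union-ˡ : (∀ x → lab ⟦ e ⟧ x ≢ j) →
    ∀ x y → ladj ⟦ join i j i≢j (union e f) ⟧ (x ↑ˡ b) (y ↑ˡ b) ≡ ladj ⟦ e ⟧ x y
  join-union-ˡ no-j x y rewrite splitAt-↑ˡ a x b | splitAt-↑ˡ a y b
    | eqB-≢ (no-j x) | eqB-≢ (no-j y) | ∧-zeroʳ (eqB (lab ⟦ e ⟧ x) i) = ∨-identityʳ _

  join-union-ʳ : (∀ y → lab ⟦ f ⟧ y ≢ i) →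
    ∀ x y → ladj ⟦ join i j i≢j (union e f) ⟧ (a ↑ʳ x) (a ↑ʳ y) ≡ ladj ⟦ f ⟧ x y
  join-union-ʳ no-i x y rewrite splitAt-↑ʳ a b x | splitAt-↑ʳ a b y
    | eqB-≢ (no-i x) | eqB-≢ (no-i y) | ∧-zeroʳ (eqB (lab ⟦ f ⟧ x) j) = ∨-identityʳ _

  join-union-ˡʳ : ∀ {x y} → lab ⟦ e ⟧ x ≡ i → lab ⟦ f ⟧ y ≡ j →
    ladj ⟦ join i j i≢j (union e f) ⟧ (x ↑ˡ b) (a ↑ʳ y) ≡ true
  join-union-ˡʳ {x} {y} lx≡i ly≡j rewrite splitAt-↑ˡ a x b | splitAt-↑ʳ a b y
    | lx≡i | ly≡j | eqB-refl i | eqB-refl j = refl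

data Consecutive {A : Set} (x y : A) : List A → Set where
  here  : ∀ {zs} → Consecutive x y (x ∷ y ∷ zs)
  there : ∀ {z zs} → Consecutive x y zs → Consecutive x y (z ∷ zs)

module _ {A : Set} where

  consecutive-∈ˡ : ∀ {x y : A} {zs} → Consecutive x y zs → x ∈ zs
  consecutive-∈ˡ here      = here refl
  consecutive-∈ˡ (there c) = there (consecutive-∈ˡ c)

  consecutive-∈ʳ : ∀ {x y : A} {zs} → Consecutive x y zs → y ∈ zs
  consecutive-∈ʳ here      = there (here refl)
  consecutive-∈ʳ (there c) = there (consecutive-∈ʳ c)

  consecutive-++⁺ʳ : ∀ {x y : A} xs {ys} → Consecutive x y ys → Consecutive x y (xs ++ ys)
  consecutive-++⁺ʳ []       c = c
  consecutive-++⁺ʳ (_ ∷ xs) c = there (consecutive-++⁺ʳ xs c)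

  unique-++⁻ʳ : ∀ (xs : List A) {ys} → Unique (xs ++ ys) → Unique ys
  unique-++⁻ʳ []       ys!       = ys!
  unique-++⁻ʳ (_ ∷ xs) (_ ∷ ys!) = unique-++⁻ʳ xs ys!

  record _≼_ (xs ys : List A) : Set where
    field
      vertices : xs ⊆ ys
      steps    : ∀ {x y} → Consecutive x y xs → Consecutive x y ys

-- The vertex sequence of a walk T u v xs is u ∷ xs.
data Walk {k : ℕ} (T : Graph k) : Fin k → Fin k → List (Fin k) → Set where
  []  : ∀ {u} → Walk T u u []
  _∷_ : ∀ {u v w xs} → Edge T u v → Walk T v w xs → Walk T u w (v ∷ xs)

module _ {k : ℕ} {T : Graph k} where

  open import Data.List.Membership.DecPropositional (_≟_ {k}) using (_∈?_)

  toWalk : ∀ {u v xs} → IsWalk T u v (u ∷ xs) → Walk T u v xs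
  toWalk {xs = []}     (_ , u≡v , _)    with just-injective u≡v
  ... | refl = []
  toWalk {xs = _ ∷ xs} (_ , ≡v , e ∷ es) = e ∷ toWalk ((xs , refl) , ≡v , es)

  fromWalk : ∀ {u v xs} → Walk T u v xs → IsWalk T u v (u ∷ xs)
  fromWalk []      = (_ , refl) , refl , [-]
  fromWalk (e ∷ w) with fromWalk w
  ... | _ , ≡v , es = (_ , refl) , ≡v , e ∷ es

  _++ʷ_ : ∀ {u v w xs ys} → Walk T u v xs → Walk T v w ys → Walk T u w (xs ++ ys)
  []      ++ʷ w′ = w′
  (e ∷ w) ++ʷ w′ = e ∷ (w ++ʷ w′)

  consecutive-++ʷ : ∀ {u v w xs ys x y} → Walk T u v xs → Walk T v w ys →
    Consecutive x y (u ∷ xs ++ ys) → Consecutive x y (u ∷ xs) ⊎ Consecutive x y (v ∷ ys)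
  consecutive-++ʷ []      _  c         = inj₂ c
  consecutive-++ʷ (_ ∷ _) _  here      = inj₁ here
  consecutive-++ʷ (_ ∷ w) w′ (there c) with consecutive-++ʷ w w′ c
  ... | inj₁ c′ = inj₁ (there c′)
  ... | inj₂ c′ = inj₂ c′

  suffixWalk : ∀ {u v w ys} pre {post} → u ∷ ys ≡ pre ++ v ∷ post → Walk T u w ys → Walk T v w post
  suffixWalk []            refl w       = w
  suffixWalk (_ ∷ [])      refl (_ ∷ w) = w
  suffixWalk (_ ∷ p ∷ pre) refl (_ ∷ w) = suffixWalk (p ∷ pre) refl w

  record PathWithin (u v : Fin k) (xs : List (Fin k)) : Set where
    field
      {path} : List (Fin k)
      walk   : Walk T u v path
      unique : Unique (u ∷ path)
      within : (u ∷ path) ≼ (u ∷ xs)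

  eraseLoops : ∀ {u v xs} → Walk T u v xs → PathWithin u v xs
  eraseLoops [] = record { walk = [] ; unique = [] ∷ [] ; within = record { vertices = id ; steps = id } }
  eraseLoops {u} {xs = v ∷ xs} (e ∷ w) with eraseLoops w
  ... | record { path = ys ; walk = π ; unique = π! ; within = π≼ } with u ∈? (v ∷ ys)
  ...   | yes u∈ = let pre , post , eq = ∈-∃++ u∈ in record
    { walk   = suffixWalk pre eq π
    ; unique = unique-++⁻ʳ pre (≡.subst Unique eq π!)
    ; within = record
      { vertices = there ∘ _≼_.vertices π≼ ∘ ≡.subst (_ ∈_) (≡.sym eq) ∘ ∈-++⁺ʳ pre
      ; steps    = there ∘ _≼_.steps π≼ ∘ ≡.subst (Consecutive _ _) (≡.sym eq) ∘ consecutive-++⁺ʳ pre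
      } }
  ...   | no u∉ = record
    { walk   = e ∷ π
    ; unique = ¬Any⇒All¬ _ u∉ ∷ π!
    ; within = record { vertices = vertices′ ; steps = steps′ } }
    where
    vertices′ : u ∷ v ∷ ys ⊆ u ∷ v ∷ xs
    vertices′ (here u≡) = here u≡
    vertices′ (there x∈) = there (_≼_.vertices π≼ x∈)
    steps′ : ∀ {x y} → Consecutive x y (u ∷ v ∷ ys) → Consecutive x y (u ∷ v ∷ xs)
    steps′ here      = here
    steps′ (there c) = there (_≼_.steps π≼ c)

module _ {k : ℕ} {T : Graph k} (isTree : IsTree T) where

  walks-unique : ∀ {u v xs ys} → Walk T u v xs → Unique (u ∷ xs) → Walk T u v ys → Unique (u ∷ ys) → xs ≡ ys
  walks-unique {u} {v} w xs! w′ ys! =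
    let _ , _ , only = proj₂ isTree u v
    in ∷-injectiveʳ (trans (only _ (fromWalk w , xs!)) (≡.sym (only _ (fromWalk w′ , ys!))))

  path≼walk : ∀ {u v xs ys} → Walk T u v ys → Unique (u ∷ ys) → Walk T u v xs → (u ∷ ys) ≼ (u ∷ xs)
  path≼walk π π! w with eraseLoops w
  ... | record { walk = σ ; unique = σ! ; within = σ≼ } with walks-unique σ σ! π π!
  ...   | refl = σ≼

  WalkIn : (Fin k → Set) → Fin k → Fin k → Set
  WalkIn S s t = Σ (List (Fin k)) λ xs → Walk T s t xs × All S (s ∷ xs)

  walkIn : ∀ {S s t} → ConnectedIn T S → S s → S t → WalkIn S s t
  walkIn c s∈ t∈ with c _ _ s∈ t∈
  ... | _ , iw@((_ , refl) , _) , all = _ , toWalk iw , all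

  connectedIn : ∀ {S} → (∀ {s t} → S s → S t → WalkIn S s t) → ConnectedIn T S
  connectedIn walks s t s∈ t∈ with walks s∈ t∈
  ... | _ , w , all = _ , fromWalk w , all

  path-inside : ∀ {S u v ys} → ConnectedIn T S → S u → S v →
    Walk T u v ys → Unique (u ∷ ys) → All S (u ∷ ys)
  path-inside c u∈ v∈ π π! with walkIn c u∈ v∈
  ... | _ , w , all = anti-mono (_≼_.vertices (path≼walk π π! w)) all

  connected-∩ : ∀ {P Q} → ConnectedIn T P → ConnectedIn T Q → ConnectedIn T (P ∩ Q)
  connected-∩ cP cQ = connectedIn λ (ps , qs) (pt , qt) →
    let _ , w , _ = walkIn cP ps pt
        record { walk = π ; unique = π! } = eraseLoops w
    in _ , π , All.zip (path-inside cP ps pt π π! , path-inside cQ qs qt π π!)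

  walkIn-++ : ∀ {P Q s r t} → WalkIn P s r → WalkIn Q r t → WalkIn (P ∪ Q) s t
  walkIn-++ (_ , w , allP) (_ , w′ , allQ) =
    _ , w ++ʷ w′ , ++⁺ (All.map inj₁ allP) (All.tail (All.map inj₂ allQ))

  connected-∪ : ∀ {P Q} → ConnectedIn T P → ConnectedIn T Q → ∃ (P ∩ Q) → ConnectedIn T (P ∪ Q)
  connected-∪ {P} {Q} cP cQ (r , pr , qr) = connectedIn walks
    where
    walks : ∀ {s t} → (P ∪ Q) s → (P ∪ Q) t → WalkIn (P ∪ Q) s t
    walks (inj₁ ps) (inj₁ pt) = let xs , w , all = walkIn cP ps pt in xs , w , All.map inj₁ all
    walks (inj₂ qs) (inj₂ qt) = let xs , w , all = walkIn cQ qs qt in xs , w , All.map inj₂ all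
    walks (inj₁ ps) (inj₂ qt) = walkIn-++ (walkIn cP ps pr) (walkIn cQ qr qt)
    walks (inj₂ qs) (inj₁ pt) =
      let xs , w , all = walkIn-++ (walkIn cQ qs qr) (walkIn cP pr pt)
      in xs , w , All.map swap all

  exit-step : ∀ {A : Fin k → Set} {x y xs} → Decidable A → Walk T x y xs → A x →
    A y ⊎ Σ (Fin k) λ p → Σ (Fin k) λ q → Consecutive p q (x ∷ xs) × A p × ¬ A q
  exit-step A? []                ax = inj₁ ax
  exit-step A? (_∷_ {v = v} _ w) ax with A? v
  ... | no ¬av = inj₂ (_ , v , here , ax , ¬av)
  ... | yes av with exit-step A? w av
  ...   | inj₁ ay                      = inj₁ ay
  ...   | inj₂ (p , q , pq , ap , ¬aq) = inj₂ (p , q , there pq , ap , ¬aq)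

  -- Let the x–y path, which lies in B, leave A at the step p q. As paths in a tree are
  -- unique, this step also occurs on the walk x → w → y; it cannot occur on the part
  -- inside A, so it occurs on the part inside C, and p lies in A ∩ B ∩ C.
  helly₃ : ∀ {A B C x y w} → Decidable A →
    ConnectedIn T A → ConnectedIn T B → ConnectedIn T C →
    (A ∩ B) x → (B ∩ C) y → (A ∩ C) w → ∃ (A ∩ B ∩ C)
  helly₃ A? cA cB cC (ax , bx) (by , cy) (aw , cw)
    with walkIn cB bx by
  ... | _ , wB , _ with eraseLoops wB
  ... | record { walk = π ; unique = π! } with exit-step A? π ax
  ...   | inj₁ ay = _ , ay , by , cy
  ...   | inj₂ (p , q , pq , ap , ¬aq) with walkIn cA ax aw | walkIn cC cw cy
  ...     | _ , wA , allA | _ , wC , allC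
    with consecutive-++ʷ wA wC (_≼_.steps (path≼walk π π! (wA ++ʷ wC)) pq)
  ...       | inj₁ pq∈wA = contradiction (All.lookup allA (consecutive-∈ʳ pq∈wA)) ¬aq
  ...       | inj₂ pq∈wC = p , ap , All.lookup (path-inside cB bx by π π!) (consecutive-∈ˡ pq)
                               , All.lookup allC (consecutive-∈ˡ pq∈wC)

  helly : ∀ {m} (S : Fin (suc m) → Fin k → Set) → (∀ i → Decidable (S i)) →
    (∀ i → ConnectedIn T (S i)) → (∀ i j → ∃ (S i ∩ S j)) → ∃ λ t → ∀ i → S i t
  helly {zero} S S? cS meets with meets zero zero
  ... | t , s , _ = t , λ { zero → s }
  helly {suc m} S S? cS meets with helly (λ i → S (suc i) ∩ S zero)
    (λ i t → S? (suc i) t ×-dec S? zero t) (λ i → connected-∩ (cS (suc i)) (cS zero)) meets′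
    where
    meets′ : ∀ i j → ∃ ((S (suc i) ∩ S zero) ∩ (S (suc j) ∩ S zero))
    meets′ i j with helly₃ (S? (suc i)) (cS (suc i)) (cS (suc j)) (cS zero)
                      (proj₂ (meets (suc i) (suc j))) (proj₂ (meets (suc j) zero)) (proj₂ (meets (suc i) zero))
    ... | z , si , sj , s0 = z , (si , s0) , (sj , s0)
  ... | t , inAll = t , λ { zero → proj₂ (inAll zero) ; (suc i) → proj₁ (inAll i) }

length-filter-∁ : ∀ {A : Set} {P : A → Set} (P? : Decidable P) xs →
  length (filter P? xs) + length (filter (∁? P?) xs) ≡ length xs
length-filter-∁ P? []       = refl
length-filter-∁ P? (x ∷ xs) with P? x
... | yes _ = cong suc (length-filter-∁ P? xs)
... | no _  = trans (+-suc _ _) (cong suc (length-filter-∁ P? xs))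

pigeonhole : ∀ {a b n} → n + n ≤ a + b → n ≤ a ⊎ n ≤ b
pigeonhole {a} {b} {n} n+n≤a+b with n ≤? a | n ≤? b
... | yes n≤a | _       = inj₁ n≤a
... | no _    | yes n≤b = inj₂ n≤b
... | no n≰a  | no n≰b  = contradiction n+n≤a+b (<⇒≱ (+-mono-< (≰⇒> n≰a) (≰⇒> n≰b)))

filter-pigeonhole : ∀ {A : Set} {P : A → Set} (P? : Decidable P) xs {n} → n + n ≤ length xs →
  n ≤ length (filter P? xs) ⊎ n ≤ length (filter (∁? P?) xs)
filter-pigeonhole P? xs n+n≤ = pigeonhole (≡.subst (_ ≤_) (≡.sym (length-filter-∁ P? xs)) n+n≤)

record InducedMatchingFamily {N : ℕ} (G : Graph N) (H : ℕ) : Set where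
  field
    u v           : Fin H → Fin N
    edge          : ∀ i → Edge G (u i) (v i)
    u-independent : ∀ i j → adj G (u i) (u j) ≡ false
    v-independent : ∀ i j → adj G (v i) (v j) ≡ false
    edge⇒≡        : ∀ i j → Edge G (u i) (v j) → i ≡ j

  embed : ∀ {N′} {G′ : Graph N′} (ι : Fin N → Fin N′) → (∀ x y → adj G′ (ι x) (ι y) ≡ adj G x y) →
    InducedMatchingFamily G′ H
  embed ι ι-adj = record
    { u             = ι ∘ u
    ; v             = ι ∘ v
    ; edge          = λ i → trans (ι-adj _ _) (edge i)
    ; u-independent = λ i j → trans (ι-adj _ _) (u-independent i j)
    ; v-independent = λ i j → trans (ι-adj _ _) (v-independent i j)
    ; edge⇒≡        = λ i j e → edge⇒≡ i j (trans (≡.sym (ι-adj _ _)) e)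
    }

  private
    true≢false : true ≢ false
    true≢false ()

  u-injective : ∀ {i j} → u i ≡ u j → i ≡ j
  u-injective {i} {j} ui≡uj = ≡.sym (edge⇒≡ j i (≡.subst (λ x → Edge G x (v i)) ui≡uj (edge i)))

  v-injective : ∀ {i j} → v i ≡ v j → i ≡ j
  v-injective {i} vi≡vj = edge⇒≡ i _ (≡.subst (Edge G (u i)) vi≡vj (edge i))

  u≢v : ∀ i j → u i ≢ v j
  u≢v i j ui≡vj = true≢false (trans (≡.sym (≡.subst (λ x → Edge G x (v i)) ui≡vj (edge i))) (v-independent j i))

  matching : List (Fin H) → List (Fin N × Fin N)
  matching = map (λ i → u i , v i)

  ∈-endpoints : ∀ {x} is → x ∈ endpoints (matching is) → Σ (Fin H) λ i → i ∈ is × (x ≡ u i ⊎ x ≡ v i)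
  ∈-endpoints (i ∷ is) (here x≡ui)         = i , here refl , inj₁ x≡ui
  ∈-endpoints (i ∷ is) (there (here x≡vi)) = i , here refl , inj₂ x≡vi
  ∈-endpoints (i ∷ is) (there (there x∈))  with ∈-endpoints is x∈
  ... | j , j∈is , x≡ = j , there j∈is , x≡

  endpoints-unique : ∀ is → Unique is → Unique (endpoints (matching is))
  endpoints-unique []       []           = []
  endpoints-unique (i ∷ is) (i∉is ∷ is!) =
    (u≢v i i ∷ All.tabulate ui∉) ∷ All.tabulate vi∉ ∷ endpoints-unique is is!
    where
    ui∉ : ∀ {x} → x ∈ endpoints (matching is) → u i ≢ x
    ui∉ x∈ ui≡x with ∈-endpoints is x∈
    ... | j , j∈is , inj₁ refl = All.lookup i∉is j∈is (u-injective ui≡x)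
    ... | j , j∈is , inj₂ refl = u≢v i j ui≡x
    vi∉ : ∀ {x} → x ∈ endpoints (matching is) → v i ≢ x
    vi∉ x∈ vi≡x with ∈-endpoints is x∈
    ... | j , j∈is , inj₁ refl = u≢v j i (≡.sym vi≡x)
    ... | j , j∈is , inj₂ refl = All.lookup i∉is j∈is (v-injective vi≡x)

  matching-induced : ∀ is x y → x ∈ endpoints (matching is) → y ∈ endpoints (matching is) →
    Edge G x y → (x , y) ∈ matching is ⊎ (y , x) ∈ matching is
  matching-induced is x y x∈ y∈ xy with ∈-endpoints is x∈ | ∈-endpoints is y∈
  ... | i , _ , inj₁ refl | j , _ , inj₁ refl = contradiction (trans (≡.sym xy) (u-independent i j)) true≢false
  ... | i , _ , inj₂ refl | j , _ , inj₂ refl = contradiction (trans (≡.sym xy) (v-independent i j)) true≢false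
  ... | i , i∈ , inj₁ refl | j , _ , inj₂ refl with edge⇒≡ i j xy
  ...   | refl = inj₁ (∈-map⁺ _ i∈)
  matching-induced is x y x∈ y∈ xy | i , _ , inj₂ refl | j , j∈ , inj₁ refl
    with edge⇒≡ j i (trans (Graph.sym G (u j) (v i)) xy)
  ...   | refl = inj₂ (∈-map⁺ _ j∈)

  matching-isInduced : ∀ is → Unique is → IsInducedMatching G (matching is)
  matching-isInduced is is! = map⁺ (universal edge is) , endpoints-unique is is! , matching-induced is

  muAtLeast : ∀ (X : Subset N) is → Unique is → All (λ i → u i ∈ₛ X) is →
    ∀ {m} → m ≤ length is → MuAtLeast G X m
  muAtLeast X is is! is⊆X m≤ =
    matching is , matching-isInduced is is! , map⁺ (All.map inj₁ is⊆X) ,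
    ≡.subst (_ ≤_) (≡.sym (length-map _ is)) m≤

open InducedMatchingFamily using (u; embed; muAtLeast)

module _ {N : ℕ} {G : Graph N} where

  muAtLeast-cover : ∀ {H n} (F F′ : InducedMatchingFamily G H) (X : Subset N) →
    (∀ i → u F i ∈ₛ X ⊎ u F′ i ∈ₛ X) →
    n + n ≤ H → MuAtLeast G X n
  muAtLeast-cover {H} F F′ X cover n+n≤H
    with filter-pigeonhole (λ i → u F i ∈ₛ? X) (allFin H)
           (≡.subst (_ ≤_) (≡.sym (length-tabulate id)) n+n≤H)
  ... | inj₁ n≤ = muAtLeast F X _ (filter⁺ _ (allFin⁺ H)) (all-filter _ (allFin H)) n≤
  ... | inj₂ n≤ = muAtLeast F′ X _ (filter⁺ _ (allFin⁺ H))
                    (All.map (λ {i} ui∉X → fromInj₂ (λ ui∈X → contradiction ui∈X ui∉X) (cover i))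
                             (all-filter _ (allFin H))) n≤

  biclique-bag : ∀ {m} (a b : Fin (suc m) → Fin N) → (∀ i j → Edge G (a i) (b j)) →
    (D : TreeDecomposition G) →
    ∃ λ t → ∀ i → a i ∈ₛ TreeDecomposition.bag D t ⊎ b i ∈ₛ TreeDecomposition.bag D t
  biclique-bag a b ab D = helly {T = tree} isTree U U? connected-U meets
    where
    open TreeDecomposition D
    U : Fin _ → Fin k → Set
    U i t = a i ∈ₛ bag t ⊎ b i ∈ₛ bag t
    U? : ∀ i → Decidable (U i)
    U? i t = (a i ∈ₛ? bag t) ⊎-dec (b i ∈ₛ? bag t)
    connected-U : ∀ i → ConnectedIn tree (U i)
    connected-U i = connected-∪ {T = tree} isTree (conn (a i)) (conn (b i)) (edgeCov (a i) (b i) (ab i i))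
    meets : ∀ i j → ∃ λ t → U i t × U j t
    meets i j with edgeCov (a i) (b j) (ab i j)
    ... | t , ai∈ , bj∈ = t , inj₁ ai∈ , inj₂ bj∈

-- Hubs of the two sides are labelled 0 and 1 and all leaves 2; once the spokes are
-- assembled, the only join is between labels 0 and 1.
leafLabel : Fin 3
leafLabel = suc (suc zero)

module Spokes (ℓ : Fin 3) (ℓ≢leaf : ℓ ≢ leafLabel) where

  spoke : CWExpr 3 2
  spoke = join ℓ leafLabel ℓ≢leaf (union (vertex ℓ) (vertex leafLabel))

  spokes : ∀ m → CWExpr 3 (suc m * 2)
  spokes zero    = spoke
  spokes (suc m) = union spoke (spokes m)

  hub leaf : ∀ {m} → Fin (suc m) → Fin (suc m * 2)
  hub zero             = zero
  hub {suc _} (suc i)  = suc (suc (hub i))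
  leaf zero            = suc zero
  leaf {suc _} (suc i) = suc (suc (leaf i))

  spoke-edge : ladj ⟦ spoke ⟧ zero (suc zero) ≡ true
  spoke-edge rewrite eqB-refl ℓ = refl

  lab-hub : ∀ m (i : Fin (suc m)) → lab ⟦ spokes m ⟧ (hub i) ≡ ℓ
  lab-hub zero    zero    = refl
  lab-hub (suc m) zero    = refl
  lab-hub (suc m) (suc i) = lab-hub m i

  hub-leaf : ∀ m (i : Fin (suc m)) → ladj ⟦ spokes m ⟧ (hub i) (leaf i) ≡ true
  hub-leaf zero    zero    = spoke-edge
  hub-leaf (suc m) zero    = spoke-edge
  hub-leaf (suc m) (suc i) = hub-leaf m i

  hub-leaf⇒≡ : ∀ m (i j : Fin (suc m)) → ladj ⟦ spokes m ⟧ (hub i) (leaf j) ≡ true → i ≡ j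
  hub-leaf⇒≡ zero    zero    zero    _  = refl
  hub-leaf⇒≡ (suc m) zero    zero    _  = refl
  hub-leaf⇒≡ (suc m) (suc i) (suc j) ij = cong suc (hub-leaf⇒≡ m i j ij)

  hub-hub : ∀ m (i j : Fin (suc m)) → ladj ⟦ spokes m ⟧ (hub i) (hub j) ≡ false
  hub-hub zero    zero    zero    = ladj-irrefl spoke zero
  hub-hub (suc m) zero    zero    = ladj-irrefl spoke zero
  hub-hub (suc m) zero    (suc j) = refl
  hub-hub (suc m) (suc i) zero    = refl
  hub-hub (suc m) (suc i) (suc j) = hub-hub m i j

  leaf-leaf : ∀ m (i j : Fin (suc m)) → ladj ⟦ spokes m ⟧ (leaf i) (leaf j) ≡ false
  leaf-leaf zero    zero    zero    = ladj-irrefl spoke (suc zero)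
  leaf-leaf (suc m) zero    zero    = ladj-irrefl spoke (suc zero)
  leaf-leaf (suc m) zero    (suc j) = refl
  leaf-leaf (suc m) (suc i) zero    = refl
  leaf-leaf (suc m) (suc i) (suc j) = leaf-leaf m i j

  family : ∀ m → InducedMatchingFamily (toGraph (spokes m)) (suc m)
  family m = record
    { u             = hub
    ; v             = leaf
    ; edge          = hub-leaf m
    ; u-independent = hub-hub m
    ; v-independent = leaf-leaf m
    ; edge⇒≡        = hub-leaf⇒≡ m
    }

  lab-spokes-≢ : ∀ {j} → ℓ ≢ j → leafLabel ≢ j → ∀ m x → lab ⟦ spokes m ⟧ x ≢ j
  lab-spokes-≢ ℓ≢j leaf≢j zero    zero          = ℓ≢j
  lab-spokes-≢ ℓ≢j leaf≢j zero    (suc zero)    = leaf≢j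
  lab-spokes-≢ ℓ≢j leaf≢j (suc m) zero          = ℓ≢j
  lab-spokes-≢ ℓ≢j leaf≢j (suc m) (suc zero)    = leaf≢j
  lab-spokes-≢ ℓ≢j leaf≢j (suc m) (suc (suc x)) = lab-spokes-≢ ℓ≢j leaf≢j m x

module PendantBiclique (h : ℕ) where

  private
    module L = Spokes zero (λ ())
    module R = Spokes (suc zero) (λ ())

    K : ℕ
    K = suc h * 2

    0≢1 : _≢_ {A = Fin 3} zero (suc zero)
    0≢1 ()

  expr : CWExpr 3 (K + K)
  expr = join zero (suc zero) 0≢1 (union (L.spokes h) (R.spokes h))

  graph : Graph (K + K)
  graph = toGraph expr

  left right : InducedMatchingFamily graph (suc h)
  left  = embed (L.family h) (_↑ˡ K)
    (join-union-ˡ 0≢1 (L.spokes h) (R.spokes h) (L.lab-spokes-≢ (λ ()) (λ ()) h))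
  right = embed (R.family h) (K ↑ʳ_)
    (join-union-ʳ 0≢1 (L.spokes h) (R.spokes h) (R.lab-spokes-≢ (λ ()) (λ ()) h))

  hubs-complete : ∀ i j → Edge graph (u left i) (u right j)
  hubs-complete i j = join-union-ˡʳ 0≢1 (L.spokes h) (R.spokes h) (L.lab-hub h i) (R.lab-hub h j)

  mmhw : ∀ {n} → n + n ≤ suc h → MMHWAtLeast graph n
  mmhw n+n≤ D with biclique-bag (u left) (u right) hubs-complete D
  ... | t , cover = t , muAtLeast-cover left right _ cover n+n≤

proposition3 : Σ ℕ λ c → Σ ℕ λ d → (n : ℕ) → 1 ≤ n →
    Σ ℕ λ N → Σ (Graph N) λ G →
      (N ≤ c * n) × CliqueWidthAtMost G d × MMHWAtLeast G n
proposition3 = 8 , 3 , λ { (suc m) _ →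
    let open PendantBiclique (m + suc m) in
    _ , graph , ≤-reflexive (size (suc m)) , cliqueWidth-toGraph expr , mmhw ≤-refl }
  where
  size : ∀ n → (n + n) * 2 + (n + n) * 2 ≡ 8 * n
  size = solve-∀
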